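{- Let $G$ be a BDH graph with color classes $X$ and $Y$. Let $\mathcal{X}_G=(X(B)\mid B\in\mathcal{B}(G))$ and $\mathcal{Y}_G=(Y(B)\mid B\in\mathcal{B}(G))$. Then the bipartite incidence graphs $\Gamma(\mathcal{X}_G)$ and $\Gamma(\mathcal{Y}_G)$ are BDH graphs.
   Context: A BDH graph is a bipartite distance hereditary graph, i.e. a bipartite graph $G$ such that for every connected induced subgraph $H$ and all $u,w\in V(H)$, $d_H(u,w)=d_G(u,w)$. A biclique is a pair $B=(U,W)$, $U\subseteq X$, $W\subseteq Y$, with every vertex of $U$ adjacent to every vertex of $W$, $X(B)=U$, $Y(B)=W$; $\mathcal{B}(G)$ is the set of maximal bicliques (inclusion-wise maximal vertex sets inducing complete bipartite subgraphs). For a family $\mathcal{H}$ of subsets of a ground set $V$, $\Gamma(\mathcal{H})$ is the bipartite graph with color classes $V$ and $\mathcal{H}$ in which $v\in V$ is adjacent to $F\in\mathcal{H}$ iff $v\in F$. -}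

module Defs where

open import Data.Nat using (ℕ; zero; suc; _≤_)
open import Data.Bool using (Bool; true; false; T)
open import Data.Fin using (Fin)
open import Data.Fin.Subset using (Subset; _∈_; _⊆_; Nonempty)
open import Data.Sum using (_⊎_; inj₁; inj₂)
open import Data.Product using (_×_; ∃; Σ; _,_)
open import Data.Unit using (⊤)
open import Relation.Binary.PropositionalEquality using (_≡_)

module Graph {V : Set} (Adj : V → V → Set) where

  data Walk (S : V → Set) : V → V → ℕ → Set where
    here : ∀ {u} → S u → Walk S u u zero
    step : ∀ {u v w k} → S u → Adj u v → Walk S v w k → Walk S u w (suc k)

  Dist : (V → Set) → V → V → ℕ → Set
  Dist S u w k = Walk S u w k × (∀ j → Walk S u w j → k ≤ j)

  Connected : (V → Set) → Set
  Connected S = ∀ u w → S u → S w → ∃ λ k → Walk S u w k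

  DistanceHereditary : (V → Set) → Set
  DistanceHereditary Vtx =
    ∀ (S : V → Bool) → (∀ v → T (S v) → Vtx v) → Connected (λ v → T (S v)) →
    ∀ u w → T (S u) → T (S w) → ∀ k →
    (Dist (λ v → T (S v)) u w k → Dist Vtx u w k) ×
    (Dist Vtx u w k → Dist (λ v → T (S v)) u w k)

BAdj : {A B : Set} → (A → B → Set) → (A ⊎ B) → (A ⊎ B) → Set
BAdj E (inj₁ a) (inj₂ b) = E a b
BAdj E (inj₂ b) (inj₁ a) = E a b
BAdj E (inj₁ _) (inj₁ _) = Data.Empty.⊥ where import Data.Empty
BAdj E (inj₂ _) (inj₂ _) = Data.Empty.⊥ where import Data.Empty

BVtx : {A B : Set} → (A → Set) → (B → Set) → (A ⊎ B) → Set
BVtx VA VB (inj₁ a) = VA a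
BVtx VA VB (inj₂ b) = VB b

BDH' : {A B : Set} → (A → B → Set) → (A → Set) → (B → Set) → Set
BDH' E VA VB = Graph.DistanceHereditary (BAdj E) (BVtx VA VB)

-- A finite bipartite graph G with color classes X = Fin m, Y = Fin n
BGraph : ℕ → ℕ → Set
BGraph m n = Fin m → Fin n → Bool

BDH : ∀ {m n} → BGraph m n → Set
BDH G = BDH' (λ x y → T (G x y)) (λ _ → ⊤) (λ _ → ⊤)

-- Bicliques (U , W), U ⊆ X, W ⊆ Y, both nonempty (so that U ∪ W induces a
-- complete bipartite graph K_{p,q}, p,q ≥ 1), every vertex of U adjacent to
-- every vertex of W.

IsBiclique : ∀ {m n} → BGraph m n → Subset m → Subset n → Set
IsBiclique G U W =
  Nonempty U × Nonempty W × (∀ x y → x ∈ U → y ∈ W → T (G x y))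

IsMaxBiclique : ∀ {m n} → BGraph m n → Subset m × Subset n → Set
IsMaxBiclique G (U , W) =
  IsBiclique G U W ×
  (∀ U' W' → IsBiclique G U' W' → U ⊆ U' → W ⊆ W' → (U ≡ U') × (W ≡ W'))

-- Γ(𝓧_G): color classes X and 𝓑(G) (one vertex per maximal biclique B,
-- representing the set X(B)); x ~ B iff x ∈ X(B).
Γ𝓧-BDH : ∀ {m n} → BGraph m n → Set
Γ𝓧-BDH {m} {n} G =
  BDH' (λ (x : Fin m) (B : Subset m × Subset n) → x ∈ Data.Product.proj₁ B)
       (λ _ → ⊤) (IsMaxBiclique G)
  where import Data.Product

-- Γ(𝓨_G): color classes Y and 𝓑(G); y ~ B iff y ∈ Y(B).
Γ𝓨-BDH : ∀ {m n} → BGraph m n → Set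
Γ𝓨-BDH {m} {n} G =
  BDH' (λ (y : Fin n) (B : Subset m × Subset n) → y ∈ Data.Product.proj₂ B)
       (λ _ → ⊤) (IsMaxBiclique G)
  where import Data.Product

module Submission where

-- A graph is distance hereditary iff each of its induced paths is a shortest walk between its
-- ends (module Walks; one direction extracts an induced path from an arbitrary walk).  We show
-- that induced paths of Γ(𝓧_G) are shortest, for an abstract incidence structure satisfying four
-- axioms on maximal bicliques (module IncidenceLift), by strong induction on the length ℓ of an
-- induced path v.  For ℓ ≤ 2 this holds in every graph.  Otherwise each biclique on v is replaced
-- by a carefully chosen vertex of its Y-part; the result is an induced path of G of length ℓ,
-- hence shortest in G, and every walk of Γ between the ends of v projects to a walk of G of the
-- same length.  Finally Γ(𝓨_G) is, up to swapping the two parts of each biclique,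
-- Γ(𝓧) of the transposed graph, and shortness of induced paths is reflected by graph embeddings.

open import Defs
open import Data.Nat using (ℕ)
open import Data.Product using (_×_)

open import Data.Nat using (zero; suc; _+_; _∸_; _≤_; _<_; z≤n; s≤s; z<s; _≤?_; _<?_)
open import Data.Nat.Properties
open import Data.Nat.Induction using (<-rec)
open import Data.Product using (∃; _,_; proj₁; proj₂) renaming (swap to pair-swap)
import Data.Product.Properties as Product
open import Data.Sum using (_⊎_; inj₁; inj₂; swap; [_,_]′) renaming (map to ⊎-map)
import Data.Sum.Properties as Sum
open import Data.Empty using (⊥; ⊥-elim)
open import Data.Bool using (Bool; true; false; T)
import Data.Bool as Bool
open import Data.Bool.Properties using (T-≡; T?)
open import Data.Fin using (Fin) renaming (_≟_ to _≟F_)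
open import Data.Fin.Properties using (any?; all?)
open import Data.Fin.Subset using (Subset; _∈_; _⊆_; _∪_; ⁅_⁆)
open import Data.Fin.Subset.Properties using (_∈?_; x∈p∪q⁺; x∈p∪q⁻; x∈⁅x⁆; x∈⁅y⁆⇒x≡y; p⊆p∪q; ⊆-antisym)
open import Data.Vec using (tabulate)
open import Data.Vec.Properties using (lookup∘tabulate; []=⇒lookup; lookup⇒[]=)
import Data.Vec.Properties as Vec
open import Function.Bundles using (Equivalence)
open import Data.Maybe using (Maybe; just; nothing)
open import Data.Maybe.Properties using (just-injective)
open import Data.Unit using (⊤; tt)
open import Relation.Nullary using (¬_; Dec; yes; no)
open import Relation.Nullary.Decidable using (_⊎-dec_; _×-dec_; _→-dec_; ¬?; ⌊_⌋; toWitness; fromWitness)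
open import Relation.Binary.PropositionalEquality
open import Relation.Binary.Definitions using (DecidableEquality)

below-suc : ∀ {k} {Q : ℕ → Set} → (∀ j → j < k → Q j) → Q k → ∀ j → j < suc k → Q j
below-suc below at-k j j<1+k with m<1+n⇒m<n∨m≡n j<1+k
... | inj₁ j<k = below j j<k
... | inj₂ refl = at-k

lastBelow : {P : ℕ → Set} → (∀ n → Dec (P n)) → ∀ k →
            (∃ λ n → n < k × P n × (∀ j → n < j → j < k → ¬ P j)) ⊎ (∀ n → n < k → ¬ P n)
lastBelow P? zero = inj₂ λ _ ()
lastBelow P? (suc k) with P? k
... | yes p = inj₁ (k , n<1+n k , p , λ j k<j j<1+k → ⊥-elim (<⇒≱ k<j (≤-pred j<1+k)))
... | no ¬p with lastBelow P? k
...   | inj₁ (n , n<k , p , above) =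
          inj₁ (n , m<n⇒m<1+n n<k , p , λ j n<j j<1+k →
                  below-suc (λ j' j'<k n<j' → above j' n<j' j'<k) (λ _ → ¬p) j j<1+k n<j)
...   | inj₂ none = inj₂ (below-suc none ¬p)

offset : ∀ {i n} → i ≤ n → ∃ λ d → n ≡ d + i
offset {i} i≤n with m≤n⇒∃[o]m+o≡n i≤n
... | d , refl = d , +-comm i d

gap : ∀ {i j} → suc i < j → ∃ λ o → j ≡ suc (suc o) + i
gap {i} lt with m≤n⇒∃[o]m+o≡n lt
... | o , refl = o , cong (λ x → suc (suc x)) (+-comm i o)

module Walks {V : Set} (Adj : V → V → Set) where
  open Graph Adj public

  IsWalkSeq : (V → Set) → (ℕ → V) → ℕ → Set
  IsWalkSeq S v ℓ = (∀ i → i ≤ ℓ → S (v i)) × (∀ i → i < ℓ → Adj (v i) (v (suc i)))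

  IsInduced : (ℕ → V) → ℕ → Set
  IsInduced v ℓ = (∀ i j → i < j → j ≤ ℓ → v i ≢ v j) ×
                  (∀ i j → suc i < j → j ≤ ℓ → ¬ Adj (v i) (v j))

  InducedPathsShortest : (V → Set) → Set
  InducedPathsShortest Vtx =
    ∀ v ℓ → IsWalkSeq Vtx v ℓ → IsInduced v ℓ → ∀ k → Walk Vtx (v 0) (v ℓ) k → ℓ ≤ k

  seq→walk : ∀ {S} v ℓ → IsWalkSeq S v ℓ → Walk S (v 0) (v ℓ) ℓ
  seq→walk v zero (inS , _) = here (inS 0 z≤n)
  seq→walk v (suc ℓ) (inS , adj) =
    step (inS 0 z≤n) (adj 0 z<s)
         (seq→walk (λ i → v (suc i)) ℓ ((λ i i≤ℓ → inS (suc i) (s≤s i≤ℓ)) , (λ i i<ℓ → adj (suc i) (s≤s i<ℓ))))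

  walk-mono : ∀ {S S' : V → Set} {u w k} → (∀ z → S z → S' z) → Walk S u w k → Walk S' u w k
  walk-mono S⊆S' (here s) = here (S⊆S' _ s)
  walk-mono S⊆S' (step s a p) = step (S⊆S' _ s) a (walk-mono S⊆S' p)

  walk-start : ∀ {S u w k} → Walk S u w k → S u
  walk-start (here s) = s
  walk-start (step s _ _) = s

  walk-length-0 : ∀ {S u w} → Walk S u w 0 → u ≡ w
  walk-length-0 (here _) = refl

  walk-length-1 : ∀ {S u w} → Walk S u w 1 → Adj u w
  walk-length-1 (step _ a (here _)) = a

  shift : ℕ → (ℕ → V) → ℕ → V
  shift i v t = v (t + i)

  shift-walk : ∀ {S v ℓ d i} → IsWalkSeq S v ℓ → d + i ≤ ℓ → IsWalkSeq S (shift i v) d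
  shift-walk {i = i} (inS , adj) le =
    (λ t t≤d → inS (t + i) (≤-trans (+-monoˡ-≤ i t≤d) le)) ,
    (λ t t<d → adj (t + i) (<-≤-trans (+-monoˡ-< i t<d) le))

  shift-induced : ∀ {v ℓ d i} → IsInduced v ℓ → d + i ≤ ℓ → IsInduced (shift i v) d
  shift-induced {i = i} (distinct , chordless) le =
    (λ t t' t<t' t'≤d → distinct (t + i) (t' + i) (+-monoˡ-< i t<t') (≤-trans (+-monoˡ-≤ i t'≤d) le)) ,
    (λ t t' t+1<t' t'≤d → chordless (t + i) (t' + i) (+-monoˡ-< i t+1<t') (≤-trans (+-monoˡ-≤ i t'≤d) le))

  cons : V → (ℕ → V) → ℕ → V
  cons u v zero = u
  cons u v (suc t) = v t

  cons-walk : ∀ {S u v ℓ} → S u → Adj u (v 0) → IsWalkSeq S v ℓ → IsWalkSeq S (cons u v) (suc ℓ)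
  cons-walk {S} {u} {v} {ℓ} su a (inS , adj) = in-S , adj'
    where
    in-S : ∀ t → t ≤ suc ℓ → S (cons u v t)
    in-S zero _ = su
    in-S (suc t) t≤ = inS t (≤-pred t≤)
    adj' : ∀ t → t < suc ℓ → Adj (cons u v t) (cons u v (suc t))
    adj' zero _ = a
    adj' (suc t) t< = adj t (≤-pred t<)

  cons-induced : ∀ {u v ℓ} → IsInduced v ℓ → (∀ j → j ≤ ℓ → u ≢ v j) →
                 (∀ j → 0 < j → j ≤ ℓ → ¬ Adj u (v j)) → IsInduced (cons u v) (suc ℓ)
  cons-induced {u} {v} {ℓ} (distinct , chordless) new far = distinct' , chordless'
    where
    distinct' : ∀ i j → i < j → j ≤ suc ℓ → cons u v i ≢ cons u v j
    distinct' zero (suc j) _ j<ℓ = new j (≤-pred j<ℓ)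
    distinct' (suc i) (suc j) i<j j<ℓ = distinct i j (≤-pred i<j) (≤-pred j<ℓ)
    chordless' : ∀ i j → suc i < j → j ≤ suc ℓ → ¬ Adj (cons u v i) (cons u v j)
    chordless' zero (suc j) 1<j j<ℓ = far j (≤-pred 1<j) (≤-pred j<ℓ)
    chordless' (suc i) (suc j) i<j j<ℓ = chordless i j (≤-pred i<j) (≤-pred j<ℓ)

  trivial-induced : ∀ v → IsInduced v 0
  trivial-induced v = (λ i j i<j j≤0 → ⊥-elim (n≮0 (<-≤-trans i<j j≤0))) ,
                      (λ i j i<j j≤0 → ⊥-elim (n≮0 (<-≤-trans i<j j≤0)))

  short-induced-shortest : ∀ {Vtx} v ℓ → ℓ ≤ 2 → IsInduced v ℓ → ∀ k → Walk Vtx (v 0) (v ℓ) k → ℓ ≤ k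
  short-induced-shortest v zero _ _ k p = z≤n
  short-induced-shortest v (suc ℓ) _ (distinct , _) zero p =
    ⊥-elim (distinct 0 (suc ℓ) z<s ≤-refl (walk-length-0 p))
  short-induced-shortest v 1 _ _ (suc k) p = s≤s z≤n
  short-induced-shortest v 2 _ (_ , chordless) 1 p = ⊥-elim (chordless 0 2 ≤-refl ≤-refl (walk-length-1 p))
  short-induced-shortest v 2 _ _ (suc (suc k)) p = s≤s (s≤s z≤n)
  short-induced-shortest v (suc (suc (suc ℓ))) (s≤s (s≤s ())) _ _ _

  snoc : ∀ {S u w z k} → Walk S u w k → Adj w z → S z → Walk S u z (suc k)
  snoc (here s) a sz = step s a (here sz)
  snoc (step s a' rest) a sz = step s a' (snoc rest a sz)

  reverse : (∀ u w → Adj u w → Adj w u) → ∀ {S u w k} → Walk S u w k → Walk S w u k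
  reverse sym-adj (here s) = here s
  reverse sym-adj (step s a rest) = snoc (reverse sym-adj rest) (sym-adj _ _ a) s

  InducedPath : (V → Set) → V → V → Set
  InducedPath S u w = ∃ λ ℓ → ∃ λ v → v 0 ≡ u × v ℓ ≡ w × IsWalkSeq S v ℓ × IsInduced v ℓ

  module Decidable (_≟_ : DecidableEquality V) (Adj? : ∀ u w → Dec (Adj u w)) where

    -- Every walk contains an induced path between its ends: shorten the tail recursively, then
    -- attach the head u at the last vertex of that path which u equals or is adjacent to.
    induced-path : ∀ {S u w k} → Walk S u w k → InducedPath S u w
    induced-path {u = u} (here s) = 0 , (λ _ → u) , refl , refl , ((λ _ _ → s) , λ _ ()) , trivial-induced _
    induced-path {S} {u} (step s a rest) with induced-path rest
    ... | ℓ , P , P0 , Pℓ , Pwalk , Pind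
        with lastBelow (λ j → (u ≟ P j) ⊎-dec Adj? u (P j)) (suc ℓ)
    ...   | inj₂ none = ⊥-elim (none 0 z<s (inj₂ (subst (Adj u) (sym P0) a)))
    ...   | inj₁ (i , i<1+ℓ , meets , later) with offset (≤-pred i<1+ℓ) | u ≟ P i
    -- u already occurs on the path: keep the part from that occurrence on
    ...     | d , refl | yes u≡Pi =
              d , shift i P , sym u≡Pi , Pℓ , shift-walk {S} Pwalk ≤-refl , shift-induced Pind ≤-refl
    -- u is adjacent to P i and to no later vertex: prepend u to the part from P i on
    ...     | d , refl | no u≢Pi =
              suc d , cons u (shift i P) , refl , Pℓ ,
              cons-walk s adjacent (shift-walk {S} Pwalk ≤-refl) ,
              cons-induced (shift-induced Pind ≤-refl) new far
      where
      adjacent : Adj u (P i)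
      adjacent = [ (λ u≡Pi → ⊥-elim (u≢Pi u≡Pi)) , (λ adj → adj) ]′ meets
      beyond : ∀ j → 0 < j → j ≤ d → i < j + i × j + i < suc (d + i)
      beyond j 0<j j≤d = m<n+m i 0<j , s≤s (+-monoˡ-≤ i j≤d)
      new : ∀ j → j ≤ d → u ≢ P (j + i)
      new zero _ = u≢Pi
      new (suc j) j<d = λ e → let (lo , hi) = beyond (suc j) z<s j<d in later _ lo hi (inj₁ e)
      far : ∀ j → 0 < j → j ≤ d → ¬ Adj u (P (j + i))
      far j 0<j j≤d adj = let (lo , hi) = beyond j 0<j j≤d in later _ lo hi (inj₂ adj)

    -- If induced paths are shortest then distances in connected induced subgraphs agree with
    -- those of the whole graph: any walk inside S contains an induced path, which is shortest.
    shortest⇒distance-hereditary : ∀ {Vtx} → InducedPathsShortest Vtx → DistanceHereditary Vtx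
    shortest⇒distance-hereditary {Vtx} shortest S S⊆Vtx connected u w su sw k with connected u w su sw
    ... | _ , p with induced-path p
    ... | ℓ , P , P0 , Pℓ , Pwalk , Pind = inside→whole , whole→inside
      where
      S' : V → Set
      S' z = T (S z)
      path : Walk S' u w ℓ
      path = subst₂ (λ a b → Walk S' a b ℓ) P0 Pℓ (seq→walk P ℓ Pwalk)
      path-shortest : ∀ j → Walk Vtx u w j → ℓ ≤ j
      path-shortest j q =
        shortest P ℓ ((λ i i≤ℓ → S⊆Vtx _ (proj₁ Pwalk i i≤ℓ)) , proj₂ Pwalk) Pind j
                 (subst₂ (λ a b → Walk Vtx a b j) (sym P0) (sym Pℓ) q)
      inside→whole : Dist S' u w k → Dist Vtx u w k
      inside→whole (q , minimal) =
        walk-mono S⊆Vtx q , λ j r → ≤-trans (minimal ℓ path) (path-shortest j r)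
      whole→inside : Dist Vtx u w k → Dist S' u w k
      whole→inside (q , minimal) =
        subst (Walk S' u w) (sym k≡ℓ) path , λ j r → subst (_≤ j) (sym k≡ℓ) (path-shortest j (walk-mono S⊆Vtx r))
        where
        k≡ℓ : k ≡ ℓ
        k≡ℓ = ≤-antisym (minimal ℓ (walk-mono S⊆Vtx path)) (path-shortest k q)

    module PathVertices {Vtx : V → Set} (v : ℕ → V) (ℓ : ℕ) (walk : IsWalkSeq Vtx v ℓ) (ind : IsInduced v ℓ) where
      on-path : V → Bool
      on-path z with lastBelow (λ i → v i ≟ z) (suc ℓ)
      ... | inj₁ _ = true
      ... | inj₂ _ = false

      OnPath : V → Set
      OnPath z = T (on-path z)

      on-path-index : ∀ z → OnPath z → ∃ λ i → i ≤ ℓ × v i ≡ z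
      on-path-index z t with lastBelow (λ i → v i ≟ z) (suc ℓ)
      ... | inj₁ (i , i<1+ℓ , e , _) = i , ≤-pred i<1+ℓ , e

      on-path-at : ∀ i → i ≤ ℓ → OnPath (v i)
      on-path-at i i≤ℓ with lastBelow (λ j → v j ≟ v i) (suc ℓ)
      ... | inj₁ _ = tt
      ... | inj₂ none = ⊥-elim (none i (s≤s i≤ℓ) refl)

      on-path⊆Vtx : ∀ z → OnPath z → Vtx z
      on-path⊆Vtx z t with on-path-index z t
      ... | i , i≤ℓ , refl = proj₁ walk i i≤ℓ

      path-walk : IsWalkSeq OnPath v ℓ
      path-walk = on-path-at , proj₂ walk

      forward : ∀ {i j} → i ≤ j → j ≤ ℓ → ∃ λ k → Walk OnPath (v i) (v j) k
      forward {i} i≤j j≤ℓ with offset i≤j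
      ... | d , refl = d , seq→walk (shift i v) d (shift-walk {OnPath} path-walk j≤ℓ)

      connected : (∀ u w → Adj u w → Adj w u) → Connected OnPath
      connected sym-adj a b ta tb with on-path-index a ta | on-path-index b tb
      ... | i , i≤ℓ , refl | j , j≤ℓ , refl with ≤-total i j
      ...   | inj₁ i≤j = forward i≤j j≤ℓ
      ...   | inj₂ j≤i = let (k , q) = forward j≤i i≤ℓ in k , reverse sym-adj q

      -- Inside the vertex set of an induced path, each step moves at most one position forward,
      -- so a walk from v a to v ℓ has length at least ℓ ∸ a.
      climb : ∀ {z j} → Walk OnPath z (v ℓ) j → ∀ a → a ≤ ℓ → v a ≡ z → ℓ ≤ a + j
      climb (here _) a a≤ℓ e with m≤n⇒m<n∨m≡n a≤ℓ
      ... | inj₁ a<ℓ = ⊥-elim (proj₁ ind a ℓ a<ℓ ≤-refl e)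
      ... | inj₂ refl = m≤m+n a 0
      climb {j = suc j} (step {v = z'} _ adj rest) a a≤ℓ e with on-path-index z' (walk-start rest)
      ... | b , b≤ℓ , eb with suc a <? b
      ...   | yes a+1<b = ⊥-elim (proj₂ ind a b a+1<b b≤ℓ (subst₂ Adj (sym e) (sym eb) adj))
      ...   | no a+1≮b = ≤-trans (climb rest b b≤ℓ eb)
                           (subst (b + j ≤_) (sym (+-suc a j)) (+-monoˡ-≤ j (≮⇒≥ a+1≮b)))

      path-distance : Dist OnPath (v 0) (v ℓ) ℓ
      path-distance = seq→walk v ℓ path-walk , λ j q → climb q 0 z≤n refl

    -- Conversely, in a distance-hereditary graph with symmetric adjacency an induced path is
    -- shortest inside its own vertex set, hence shortest in the whole graph.
    distance-hereditary⇒shortest : (∀ u w → Adj u w → Adj w u) →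
                                   ∀ {Vtx} → DistanceHereditary Vtx → InducedPathsShortest Vtx
    distance-hereditary⇒shortest sym-adj {Vtx} dh v ℓ walk ind k p =
      proj₂ (proj₁ (dh on-path on-path⊆Vtx (connected sym-adj) (v 0) (v ℓ)
                       (on-path-at 0 z≤n) (on-path-at ℓ ≤-refl) ℓ) path-distance) k p
      where open PathVertices {Vtx} v ℓ walk ind

-- A graph embedding (injective, preserving and reflecting adjacency and the vertex set) maps
-- induced paths to induced paths and walks to walks, so it reflects the property that induced
-- paths are shortest.
embedding-reflects-shortest :
  ∀ {V V' : Set} {Adj : V → V → Set} {Adj' : V' → V' → Set} {Vtx : V → Set} {Vtx' : V' → Set}
  (f : V → V') → (∀ {x y} → f x ≡ f y → x ≡ y) →
  (∀ x y → Adj x y → Adj' (f x) (f y)) → (∀ x y → Adj' (f x) (f y) → Adj x y) →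
  (∀ x → Vtx x → Vtx' (f x)) →
  Walks.InducedPathsShortest Adj' Vtx' → Walks.InducedPathsShortest Adj Vtx
embedding-reflects-shortest {Adj = Adj} {Adj'} {Vtx} {Vtx'} f f-injective f-adj f-adj⁻ f-vtx shortest'
                            v ℓ (inS , adj) (distinct , chordless) k p =
  shortest' (λ i → f (v i)) ℓ
    ((λ i i≤ℓ → f-vtx _ (inS i i≤ℓ)) , (λ i i<ℓ → f-adj _ _ (adj i i<ℓ)))
    ((λ i j i<j j≤ℓ e → distinct i j i<j j≤ℓ (f-injective e)) ,
     (λ i j i+1<j j≤ℓ a → chordless i j i+1<j j≤ℓ (f-adj⁻ _ _ a)))
    k (map-walk p)
  where
  map-walk : ∀ {u w k} → Walks.Walk Adj Vtx u w k → Walks.Walk Adj' Vtx' (f u) (f w) k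
  map-walk (Graph.here s) = Graph.here (f-vtx _ s)
  map-walk (Graph.step s a rest) = Graph.step (f-vtx _ s) (f-adj _ _ a) (map-walk rest)

BipartiteShortest : {A B : Set} → (A → B → Set) → (A → Set) → (B → Set) → Set
BipartiteShortest R VA VB = Walks.InducedPathsShortest (BAdj R) (BVtx VA VB)

BAdj-sym : {A B : Set} (R : A → B → Set) → ∀ z z' → BAdj R z z' → BAdj R z' z
BAdj-sym R (inj₁ a) (inj₂ b) r = r
BAdj-sym R (inj₂ b) (inj₁ a) r = r

BAdj? : {A B : Set} {R : A → B → Set} → (∀ a b → Dec (R a b)) → ∀ z z' → Dec (BAdj R z z')
BAdj? R? (inj₁ a) (inj₂ b) = R? a b
BAdj? R? (inj₂ b) (inj₁ a) = R? a b
BAdj? R? (inj₁ _) (inj₁ _) = no λ ()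
BAdj? R? (inj₂ _) (inj₂ _) = no λ ()

module BipartiteCriterion {A B : Set} {R : A → B → Set} {VA : A → Set} {VB : B → Set}
  (_≟A_ : DecidableEquality A) (_≟B_ : DecidableEquality B) (R? : ∀ a b → Dec (R a b)) where
  open Walks.Decidable (BAdj R) (Sum.≡-dec _≟A_ _≟B_) (BAdj? R?)

  shortest⇒BDH : BipartiteShortest R VA VB → BDH' R VA VB
  shortest⇒BDH = shortest⇒distance-hereditary

  BDH⇒shortest : BDH' R VA VB → BipartiteShortest R VA VB
  BDH⇒shortest = distance-hereditary⇒shortest (BAdj-sym R)

swap-sides-shortest : {A B : Set} {R : A → B → Set} {VA : A → Set} {VB : B → Set} →
                      BipartiteShortest R VA VB → BipartiteShortest (λ b a → R a b) VB VA
swap-sides-shortest {R = R} {VA} {VB} =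
  embedding-reflects-shortest swap swap-injective swap-adj swap-adj⁻ swap-vtx
  where
  swap-injective : ∀ {x y} → swap x ≡ swap y → x ≡ y
  swap-injective {x} {y} e = trans (sym (Sum.swap-involutive x)) (trans (cong swap e) (Sum.swap-involutive y))
  swap-adj : ∀ z z' → BAdj (λ b a → R a b) z z' → BAdj R (swap z) (swap z')
  swap-adj (inj₁ b) (inj₂ a) r = r
  swap-adj (inj₂ a) (inj₁ b) r = r
  swap-adj⁻ : ∀ z z' → BAdj R (swap z) (swap z') → BAdj (λ b a → R a b) z z'
  swap-adj⁻ (inj₁ b) (inj₂ a) r = r
  swap-adj⁻ (inj₂ a) (inj₁ b) r = r
  swap-vtx : ∀ z → BVtx VB VA z → BVtx VA VB (swap z)
  swap-vtx (inj₁ b) s = s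
  swap-vtx (inj₂ a) s = s

relabel-shortest : {A B B' : Set} {R : A → B → Set} {R' : A → B' → Set} {VA : A → Set}
                   {VB : B → Set} {VB' : B' → Set} (g : B → B') → (∀ {b c} → g b ≡ g c → b ≡ c) →
                   (∀ a b → R a b → R' a (g b)) → (∀ a b → R' a (g b) → R a b) → (∀ b → VB b → VB' (g b)) →
                   BipartiteShortest R' VA VB' → BipartiteShortest R VA VB
relabel-shortest {R = R} {R'} {VA} {VB} {VB'} g g-injective g-inc g-inc⁻ g-vtx =
  embedding-reflects-shortest (⊎-map (λ a → a) g) map-injective map-adj map-adj⁻ map-vtx
  where
  map-injective : ∀ {x y} → ⊎-map (λ a → a) g x ≡ ⊎-map (λ a → a) g y → x ≡ y
  map-injective {inj₁ _} {inj₁ _} refl = refl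
  map-injective {inj₂ _} {inj₂ _} e = cong inj₂ (g-injective (Sum.inj₂-injective e))
  map-injective {inj₁ _} {inj₂ _} ()
  map-injective {inj₂ _} {inj₁ _} ()
  map-adj : ∀ z z' → BAdj R z z' → BAdj R' (⊎-map (λ a → a) g z) (⊎-map (λ a → a) g z')
  map-adj (inj₁ a) (inj₂ b) r = g-inc a b r
  map-adj (inj₂ b) (inj₁ a) r = g-inc a b r
  map-adj⁻ : ∀ z z' → BAdj R' (⊎-map (λ a → a) g z) (⊎-map (λ a → a) g z') → BAdj R z z'
  map-adj⁻ (inj₁ a) (inj₂ b) r = g-inc⁻ a b r
  map-adj⁻ (inj₂ b) (inj₁ a) r = g-inc⁻ a b r
  map-vtx : ∀ z → BVtx VA VB z → BVtx VA VB' (⊎-map (λ a → a) g z)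
  map-vtx (inj₁ a) s = s
  map-vtx (inj₂ b) s = g-vtx b s

-- A base bipartite graph E between A and C, and a
-- family B of "maximal bicliques": each maximal b has a nonempty C-part, its A-part and C-part
-- are completely joined, every a outside the A-part misses some vertex of the C-part
-- (maximality), and any two A-vertices with a common neighbour lie in a common maximal biclique
-- (the neighbourhood of that neighbour extends to one).  Γ is the incidence graph between A and
-- the maximal bicliques.
module IncidenceLift
  {A C B : Set} (E : A → C → Set) (InA : A → B → Set) (InC : C → B → Set) (Max : B → Set)
  (E? : ∀ a c → Dec (E a c)) (InC? : ∀ c b → Dec (InC c b))
  (searchC : ∀ {P : C → Set} → (∀ c → Dec (P c)) → Dec (∃ P))
  (nonempty : ∀ {b} → Max b → ∃ λ c → InC c b)
  (complete : ∀ {a c b} → Max b → InA a b → InC c b → E a c)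
  (maximal : ∀ {a b} → Max b → ¬ InA a b → ∃ λ c → InC c b × ¬ E a c)
  (star : ∀ {a a' c} → E a c → E a' c → ∃ λ b → Max b × InA a b × InA a' b)
  where

  module Base = Walks (BAdj E)
  module Inc = Walks (BAdj InA)
  open Graph using (here; step)

  Vtx₀ : A ⊎ C → Set
  Vtx₀ = BVtx (λ _ → ⊤) (λ _ → ⊤)

  VtxΓ : A ⊎ B → Set
  VtxΓ = BVtx (λ _ → ⊤) Max

  everywhere : ∀ z → Vtx₀ z
  everywhere (inj₁ _) = tt
  everywhere (inj₂ _) = tt

  Represents : A ⊎ B → A ⊎ C → Set
  Represents (inj₁ a) z = z ≡ inj₁ a
  Represents (inj₂ b) z = ∃ λ c → z ≡ inj₂ c × InC c b × Max b

  represent-adj : ∀ {u z u' z'} → BAdj InA u z → Represents u u' → Represents z z' → BAdj E u' z'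
  represent-adj {inj₁ a} {inj₂ b} ma refl (c , refl , mc , mx) = complete mx ma mc
  represent-adj {inj₂ b} {inj₁ a} ma (c , refl , mc , mx) refl = complete mx ma mc

  representative : ∀ z → VtxΓ z → ∃ (Represents z)
  representative (inj₁ a) _ = inj₁ a , refl
  representative (inj₂ b) mx = let (c , mc) = nonempty mx in inj₂ c , c , refl , mc , mx

  project : ∀ {u w u' w' k} → Inc.Walk VtxΓ u w (suc k) → Represents u u' → Represents w w' →
            Base.Walk Vtx₀ u' w' (suc k)
  project {u' = u'} {w'} (step _ a (here _)) ru rw =
    step (everywhere u') (represent-adj a ru rw) (here (everywhere w'))
  project {u' = u'} (step _ a rest@(step {u = z} sz _ _)) ru rw =
    let (z' , rz) = representative z sz
    in step (everywhere u') (represent-adj a ru rz) (project rest rz rw)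

  biclique-neighbour : ∀ {b} z → BAdj InA (inj₂ b) z → ∃ λ a → z ≡ inj₁ a × InA a b
  biclique-neighbour (inj₁ a) ma = a , refl , ma

  vertex-neighbour : ∀ {a} z → BAdj InA (inj₁ a) z → ∃ λ b → z ≡ inj₂ b
  vertex-neighbour (inj₂ b) _ = b , refl

  ShortestAt : ℕ → Set
  ShortestAt ℓ = ∀ v → Inc.IsWalkSeq VtxΓ v ℓ → Inc.IsInduced v ℓ →
                 ∀ k → Inc.Walk VtxΓ (v 0) (v ℓ) k → ℓ ≤ k

  -- Let v be an induced path of Γ of length ℓ ≥ 3 and assume shorter induced
  -- paths of Γ are shortest.  Lift v to the base graph by replacing each biclique v q with a vertex
  -- of its C-part; near the ends of the path this vertex is chosen to avoid the A-vertex at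
  -- distance 3 (the target of q).  The lift is an induced path of the base graph, hence shortest
  -- there, and every walk of Γ between the ends of v projects to a base walk of equal length.
  module Lift (base : Base.InducedPathsShortest Vtx₀) (ℓ : ℕ) (3≤ℓ : 3 ≤ ℓ)
              (IH : ∀ {ℓ'} → ℓ' < ℓ → ShortestAt ℓ')
              (v : ℕ → A ⊎ B) (walk : Inc.IsWalkSeq VtxΓ v ℓ) (ind : Inc.IsInduced v ℓ) where

    0<ℓ : 0 < ℓ
    0<ℓ = ≤-trans (s≤s z≤n) 3≤ℓ

    edge : ∀ i → i < ℓ → BAdj InA (v i) (v (suc i))
    edge = proj₂ walk

    max-at : ∀ {q b} → q ≤ ℓ → v q ≡ inj₂ b → Max b
    max-at {q} q≤ℓ e = subst VtxΓ e (proj₁ walk q q≤ℓ)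

    after-biclique : ∀ {i b} → i < ℓ → v i ≡ inj₂ b → ∃ λ a → v (suc i) ≡ inj₁ a × InA a b
    after-biclique {i} i<ℓ e =
      biclique-neighbour (v (suc i)) (subst (λ z → BAdj InA z (v (suc i))) e (edge i i<ℓ))

    before-biclique : ∀ {i b} → i < ℓ → v (suc i) ≡ inj₂ b → ∃ λ a → v i ≡ inj₁ a × InA a b
    before-biclique {i} i<ℓ e =
      biclique-neighbour (v i) (BAdj-sym InA (v i) _ (subst (BAdj InA (v i)) e (edge i i<ℓ)))

    after-vertex : ∀ {i a} → i < ℓ → v i ≡ inj₁ a → ∃ λ b → v (suc i) ≡ inj₂ b
    after-vertex {i} i<ℓ e =
      vertex-neighbour (v (suc i)) (subst (λ z → BAdj InA z (v (suc i))) e (edge i i<ℓ))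

    -- A-vertices of the path at distance d with 3 ≤ d < ℓ have no common neighbour in the base
    -- graph: otherwise they lie in a common biclique, so the subpath between them, an induced path
    -- shorter than ℓ, would not be shortest.
    far-apart : ∀ {i d a a' c} → d + i ≤ ℓ → 3 ≤ d → d < ℓ → v i ≡ inj₁ a → v (d + i) ≡ inj₁ a' →
                E a c → E a' c → ⊥
    far-apart {i} {d} le 3≤d d<ℓ e e' ea ea' with star ea ea'
    ... | b , mx , ma , ma' =
      <⇒≱ 3≤d (IH d<ℓ (Inc.shift i v) (Inc.shift-walk {VtxΓ} {v} walk le) (Inc.shift-induced {v} ind le) 2 detour)
      where
      detour : Inc.Walk VtxΓ (v i) (v (d + i)) 2
      detour = subst₂ (λ x y → Inc.Walk VtxΓ x y 2) (sym e) (sym e') (step {v = inj₂ b} tt ma (step mx ma' (here tt)))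

    targetPos : ℕ → Maybe ℕ
    targetPos q with (q ≤? 1) ×-dec (3 + q ≤? ℓ) | (3 ≤? q) ×-dec (ℓ ≤? suc q)
    ... | yes _ | _     = just (3 + q)
    ... | no _  | yes _ = just (q ∸ 3)
    ... | no _  | no _  = nothing

    targetPos-right : ∀ {q} → q ≤ 1 → 3 + q ≤ ℓ → targetPos q ≡ just (3 + q)
    targetPos-right {q} q≤1 le with (q ≤? 1) ×-dec (3 + q ≤? ℓ)
    ... | yes _ = refl
    ... | no n = ⊥-elim (n (q≤1 , le))

    targetPos-left : ∀ {q} → 3 ≤ q → ℓ ≤ suc q → targetPos q ≡ just (q ∸ 3)
    targetPos-left {q} 3≤q le with (q ≤? 1) ×-dec (3 + q ≤? ℓ) | (3 ≤? q) ×-dec (ℓ ≤? suc q)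
    ... | yes (q≤1 , _) | _ = ⊥-elim (<⇒≱ (s≤s (s≤s z≤n)) (≤-trans 3≤q q≤1))
    ... | no _ | yes _ = refl
    ... | no _ | no n = ⊥-elim (n (3≤q , le))

    targetPos-sound : ∀ {q p} → q ≤ ℓ → targetPos q ≡ just p → p ≤ ℓ × (p ≡ 3 + q ⊎ q ≡ 3 + p)
    targetPos-sound {q} q≤ℓ t with (q ≤? 1) ×-dec (3 + q ≤? ℓ) | (3 ≤? q) ×-dec (ℓ ≤? suc q)
    targetPos-sound q≤ℓ refl | yes (_ , le) | _ = le , inj₁ refl
    targetPos-sound {q} q≤ℓ refl | no _ | yes (3≤q , _) =
      ≤-trans (m∸n≤m q 3) q≤ℓ , inj₂ (sym (m+[n∸m]≡n 3≤q))
    targetPos-sound q≤ℓ () | no _ | no _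

    vertexAt : A ⊎ B → Maybe A
    vertexAt (inj₁ a) = just a
    vertexAt (inj₂ _) = nothing

    targetAt : Maybe ℕ → Maybe A
    targetAt nothing = nothing
    targetAt (just p) = vertexAt (v p)

    -- The A-vertex that the lift of v q has to avoid, if any.
    target : ℕ → Maybe A
    target q = targetAt (targetPos q)

    target-right : ∀ {q a} → q ≤ 1 → 3 + q ≤ ℓ → v (3 + q) ≡ inj₁ a → target q ≡ just a
    target-right q≤1 le e = trans (cong targetAt (targetPos-right q≤1 le)) (cong vertexAt e)

    target-left : ∀ {q a} → 3 ≤ q → ℓ ≤ suc q → v (q ∸ 3) ≡ inj₁ a → target q ≡ just a
    target-left 3≤q le e = trans (cong targetAt (targetPos-left 3≤q le)) (cong vertexAt e)

    target-position : ∀ {q a} → target q ≡ just a → ∃ λ p → targetPos q ≡ just p × v p ≡ inj₁ a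
    target-position {q} t with targetPos q
    target-position () | nothing
    target-position t | just p with v p in e
    target-position t | just p | inj₁ a' = p , refl , trans e (cong inj₁ (just-injective t))
    target-position () | just p | inj₂ _

    -- A biclique on the path does not contain its target (that would be a chord of the path).
    target-outside : ∀ {q a b} → q ≤ ℓ → v q ≡ inj₂ b → target q ≡ just a → ¬ InA a b
    target-outside {q} q≤ℓ eb t ma with target-position t
    ... | p , tp , ep with targetPos-sound q≤ℓ tp
    ...   | p≤ℓ , inj₁ refl = proj₂ ind q p (s≤s (s≤s (n≤1+n q))) p≤ℓ (subst₂ (BAdj InA) (sym eb) (sym ep) ma)
    ...   | p≤ℓ , inj₂ refl = proj₂ ind p q (s≤s (s≤s (n≤1+n p))) q≤ℓ (subst₂ (BAdj InA) (sym ep) (sym eb) ma)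

    Avoids : Maybe A → C → Set
    Avoids nothing _ = ⊤
    Avoids (just a) c = ¬ E a c

    avoids? : ∀ t c → Dec (Avoids t c)
    avoids? nothing _ = yes tt
    avoids? (just a) c = ¬? (E? a c)

    avoids : ∀ {t a c} → Avoids t c → t ≡ just a → ¬ E a c
    avoids av refl = av

    -- An A-vertex of the path, used only to make the lift a total function.
    anchor : A
    anchor with v 0 in e
    ... | inj₁ a = a
    ... | inj₂ b = proj₁ (after-biclique 0<ℓ e)

    choose : B → Maybe A → A ⊎ C
    choose b t with searchC (λ c → InC? c b ×-dec avoids? t c)
    ... | yes (c , _) = inj₂ c
    ... | no _ = inj₁ anchor

    choose-spec : ∀ {b t} → Max b → (∀ {a} → t ≡ just a → ¬ InA a b) →
                  ∃ λ c → choose b t ≡ inj₂ c × InC c b × Avoids t c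
    choose-spec {b} {t} mx outside with searchC (λ c → InC? c b ×-dec avoids? t c)
    ... | yes (c , mc , av) = c , refl , mc , av
    ... | no none = ⊥-elim (none (candidate t outside))
      where
      candidate : ∀ t → (∀ {a} → t ≡ just a → ¬ InA a b) → ∃ λ c → InC c b × Avoids t c
      candidate nothing _ = let (c , mc) = nonempty mx in c , mc , tt
      candidate (just a) out = maximal mx (out refl)

    liftVertex : ℕ → A ⊎ B → A ⊎ C
    liftVertex q (inj₁ a) = inj₁ a
    liftVertex q (inj₂ b) = choose b (target q)

    W : ℕ → A ⊎ C
    W q = liftVertex q (v q)

    lift-vertex : ∀ {q a} → v q ≡ inj₁ a → W q ≡ inj₁ a
    lift-vertex {q} e = cong (liftVertex q) e

    lift-biclique : ∀ {q b} → q ≤ ℓ → v q ≡ inj₂ b → ∃ λ c → W q ≡ inj₂ c × InC c b × Avoids (target q) c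
    lift-biclique {q} q≤ℓ e with choose-spec (max-at q≤ℓ e) (target-outside q≤ℓ e)
    ... | c , chosen , mc , av = c , trans (cong (liftVertex q) e) chosen , mc , av

    lift-represents : ∀ q → q ≤ ℓ → Represents (v q) (W q)
    lift-represents q q≤ℓ = by-cases (v q) refl
      where
      by-cases : ∀ z → v q ≡ z → Represents z (W q)
      by-cases (inj₁ a) e = lift-vertex e
      by-cases (inj₂ b) e = let (c , wc , mc , _) = lift-biclique q≤ℓ e in c , wc , mc , max-at q≤ℓ e

    -- Distance 2 is impossible on a path of Γ; at distance 3 we use the A-vertex before the biclique
    -- (at distance 4) or, at the left end, the choice of c; at larger distances the A-vertex
    -- after the biclique.
    no-chord-right : ∀ {q o a b c} → suc (suc o) + q ≤ ℓ → v q ≡ inj₂ b → InC c b →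
                     Avoids (target q) c → v (suc (suc o) + q) ≡ inj₁ a → E a c → ⊥
    no-chord-right {q} {zero} le eb _ _ ea _ with after-biclique (≤-trans (n≤1+n (suc q)) le) eb
    ... | _ , e1 , _ = subst₂ (BAdj InA) e1 ea (edge (suc q) le)
    no-chord-right {zero} {1} le _ _ av ea eac = avoids av (target-right z≤n le ea) eac
    no-chord-right {suc q} {1} le eb mc av ea eac with 5 ≤? ℓ
    ... | no 5≰ℓ = avoids av (target-right (s≤s q≤0) le ea) eac
      where
      q≤0 : q ≤ 0
      q≤0 = +-cancelˡ-≤ 4 q 0 (≤-pred (≤-trans (s≤s le) (≰⇒> 5≰ℓ)))
    ... | yes 5≤ℓ with before-biclique (≤-trans (m≤n+m (suc q) 3) le) eb
    ...   | a' , e' , ma' =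
      far-apart {q} {4} le (s≤s (s≤s (s≤s z≤n))) 5≤ℓ e' ea (complete (max-at (≤-trans (m≤n+m (suc q) 3) le) eb) ma' mc) eac
    no-chord-right {q} {suc (suc o)} {a} le eb mc av ea eac
      with after-biclique (≤-trans (s≤s (m≤n+m q (suc (suc (suc o))))) le) eb
    ... | a' , e' , ma' =
      far-apart {suc q} {3 + o} (subst (_≤ ℓ) (sym shifted) le) (s≤s (s≤s (s≤s z≤n)))
                (≤-trans (s≤s (s≤s (s≤s (s≤s (m≤m+n o q))))) le)
                e' (subst (λ x → v x ≡ inj₁ a) (sym shifted) ea)
                (complete (max-at (≤-trans (m≤n+m q _) le) eb) ma' mc) eac
      where
      shifted : 3 + o + suc q ≡ 4 + o + q
      shifted = cong (λ x → 3 + x) (+-suc o q)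

    no-chord-left : ∀ {p o a b c} → suc (suc o) + p ≤ ℓ → v p ≡ inj₁ a → v (suc (suc o) + p) ≡ inj₂ b →
                    InC c b → Avoids (target (suc (suc o) + p)) c → E a c → ⊥
    no-chord-left {p} {zero} le ea eb _ _ _ with after-vertex (≤-trans (n≤1+n (suc p)) le) ea
    ... | _ , e1 = subst₂ (BAdj InA) e1 eb (edge (suc p) le)
    no-chord-left {p} {1} le ea eb mc av eac with 4 + p ≤? ℓ | 5 ≤? ℓ
    ... | no 4+p≰ℓ | _ = avoids av (target-left (s≤s (s≤s (s≤s z≤n))) (<⇒≤ (≰⇒> 4+p≰ℓ)) ea) eac
    ... | yes _ | no 5≰ℓ =
      avoids av (target-left (s≤s (s≤s (s≤s z≤n))) (≤-trans (≤-pred (≰⇒> 5≰ℓ)) (m≤m+n 4 p)) ea) eac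
    ... | yes 4+p≤ℓ | yes 5≤ℓ with after-biclique 4+p≤ℓ eb
    ...   | a' , e' , ma' = far-apart {p} {4} 4+p≤ℓ (s≤s (s≤s (s≤s z≤n))) 5≤ℓ ea e' eac (complete (max-at le eb) ma' mc)
    no-chord-left {p} {suc (suc o)} le ea eb mc av eac with before-biclique le eb
    ... | a' , e' , ma' =
      far-apart {p} {3 + o} (≤-trans (n≤1+n _) le) (s≤s (s≤s (s≤s z≤n)))
                (≤-trans (s≤s (s≤s (s≤s (s≤s (m≤m+n o p))))) le) ea e' eac (complete (max-at le eb) ma' mc)

    -- Two bicliques of the path never share their lift: an A-neighbour of one of them would be
    -- adjacent to the lift of the other.
    shared-lift : ∀ {i j b b' c} → i < j → j ≤ ℓ → v i ≡ inj₂ b → v j ≡ inj₂ b' → InC c b → InC c b' →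
                  Avoids (target i) c → Avoids (target j) c → ⊥
    shared-lift {suc i} i<j j≤ℓ ei ej mc mc' _ av' with before-biclique (<⇒≤ (<-≤-trans i<j j≤ℓ)) ei
    ... | a , ea , ma with gap i<j
    ...   | o , refl = no-chord-left j≤ℓ ea ej mc' av' (complete (max-at (<⇒≤ (<-≤-trans i<j j≤ℓ)) ei) ma mc)
    shared-lift {zero} {j} i<j j≤ℓ ei ej mc mc' av av' with m≤n⇒m<n∨m≡n j≤ℓ
    ... | inj₁ j<ℓ with after-biclique j<ℓ ej | gap (s≤s i<j)
    ...   | a , ea , ma | o , eq =
      no-chord-right (subst (_≤ ℓ) eq j<ℓ) ei mc av (subst (λ x → v x ≡ inj₁ a) eq ea) (complete (max-at j≤ℓ ej) ma mc')
    shared-lift {zero} {j} i<j j≤ℓ ei ej mc mc' av av' | inj₂ j≡ℓ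
      with after-biclique 0<ℓ ei | gap (subst (2 <_) (sym j≡ℓ) 3≤ℓ)
    ... | a , ea , ma | o , refl = no-chord-left j≤ℓ ea ej mc' av' (complete (max-at z≤n ei) ma mc)

    lift-distinct : ∀ i j → i < j → j ≤ ℓ → W i ≢ W j
    lift-distinct i j i<j j≤ℓ = by-cases (v i) (v j) refl refl
      where
      i≤ℓ : i ≤ ℓ
      i≤ℓ = ≤-trans (<⇒≤ i<j) j≤ℓ
      by-cases : ∀ z z' → v i ≡ z → v j ≡ z' → W i ≢ W j
      by-cases (inj₁ a) (inj₁ a') ei ej e =
        proj₁ ind i j i<j j≤ℓ (trans ei (trans (cong inj₁ (Sum.inj₁-injective same)) (sym ej)))
        where
        same : inj₁ a ≡ inj₁ a'
        same = trans (sym (lift-vertex ei)) (trans e (lift-vertex ej))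
      by-cases (inj₁ a) (inj₂ b) ei ej e with lift-biclique j≤ℓ ej
      ... | c , wj , _ with trans (sym (lift-vertex ei)) (trans e wj)
      ...   | ()
      by-cases (inj₂ b) (inj₁ a) ei ej e with lift-biclique i≤ℓ ei
      ... | c , wi , _ with trans (sym wi) (trans e (lift-vertex ej))
      ...   | ()
      by-cases (inj₂ b) (inj₂ b') ei ej e with lift-biclique i≤ℓ ei | lift-biclique j≤ℓ ej
      ... | c , wi , mc , av | c' , wj , mc' , av' with Sum.inj₂-injective (trans (sym wi) (trans e wj))
      ...   | refl = shared-lift i<j j≤ℓ ei ej mc mc' av av'

    lift-chordless : ∀ i j → suc i < j → j ≤ ℓ → ¬ BAdj E (W i) (W j)
    lift-chordless i j i+1<j j≤ℓ with gap i+1<j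
    ... | o , refl = by-cases (v i) (v (suc (suc o) + i)) refl refl
      where
      i≤ℓ : i ≤ ℓ
      i≤ℓ = ≤-trans (m≤n+m i _) j≤ℓ
      by-cases : ∀ z z' → v i ≡ z → v (suc (suc o) + i) ≡ z' → ¬ BAdj E (W i) (W (suc (suc o) + i))
      by-cases (inj₁ a) (inj₁ a') ei ej adj = subst₂ (BAdj E) (lift-vertex ei) (lift-vertex ej) adj
      by-cases (inj₁ a) (inj₂ b) ei ej adj with lift-biclique j≤ℓ ej
      ... | c , wj , mc , av = no-chord-left j≤ℓ ei ej mc av (subst₂ (BAdj E) (lift-vertex ei) wj adj)
      by-cases (inj₂ b) (inj₁ a) ei ej adj with lift-biclique i≤ℓ ei
      ... | c , wi , mc , av = no-chord-right j≤ℓ ei mc av ej (subst₂ (BAdj E) wi (lift-vertex ej) adj)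
      by-cases (inj₂ b) (inj₂ b') ei ej adj with lift-biclique i≤ℓ ei | lift-biclique j≤ℓ ej
      ... | c , wi , _ | c' , wj , _ = subst₂ (BAdj E) wi wj adj

    lift-walk : Base.IsWalkSeq Vtx₀ W ℓ
    lift-walk = (λ i _ → everywhere (W i)) ,
                (λ i i<ℓ → represent-adj (edge i i<ℓ) (lift-represents i (<⇒≤ i<ℓ)) (lift-represents (suc i) i<ℓ))

    lift-induced : Base.IsInduced W ℓ
    lift-induced = lift-distinct , lift-chordless

    -- ... so projecting a walk of Γ between the ends of v onto it shows that v is shortest.
    path-shortest : ∀ k → Inc.Walk VtxΓ (v 0) (v ℓ) k → ℓ ≤ k
    path-shortest zero p = ⊥-elim (proj₁ ind 0 ℓ 0<ℓ ≤-refl (Inc.walk-length-0 p))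
    path-shortest (suc k) p =
      base W ℓ lift-walk lift-induced (suc k) (project p (lift-represents 0 z≤n) (lift-represents ℓ ≤-refl))

  incidence-shortest : Base.InducedPathsShortest Vtx₀ → Inc.InducedPathsShortest VtxΓ
  incidence-shortest base v ℓ = <-rec ShortestAt shortest-at ℓ v
    where
    shortest-at : ∀ ℓ → (∀ {ℓ'} → ℓ' < ℓ → ShortestAt ℓ') → ShortestAt ℓ
    shortest-at ℓ IH v walk ind with ℓ ≤? 2
    ... | yes ℓ≤2 = Inc.short-induced-shortest v ℓ ℓ≤2 ind
    ... | no ℓ≰2 = Lift.path-shortest base ℓ (≰⇒> ℓ≰2) IH v walk ind

∈-tabulate⁺ : ∀ {k} (f : Fin k → Bool) x → T (f x) → x ∈ tabulate f
∈-tabulate⁺ f x t = lookup⇒[]= x (tabulate f) (trans (lookup∘tabulate f x) (Equivalence.to T-≡ t))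

∈-tabulate⁻ : ∀ {k} (f : Fin k → Bool) x → x ∈ tabulate f → T (f x)
∈-tabulate⁻ f x x∈ = Equivalence.from T-≡ (trans (sym (lookup∘tabulate f x)) ([]=⇒lookup x∈))

module MaximalBicliques {m n : ℕ} (G : BGraph m n) where

  -- Maximality: a vertex x ∉ U misses some y ∈ W, since otherwise (U ∪ {x}, W) would be a
  -- strictly larger biclique.
  outside-misses : ∀ {x B} → IsMaxBiclique G B → ¬ x ∈ proj₁ B → ∃ λ y → y ∈ proj₂ B × ¬ T (G x y)
  outside-misses {x} {U , W} ((_ , W-nonempty , joined) , maximal) x∉U
    with any? (λ y → (y ∈? W) ×-dec ¬? (T? (G x y)))
  ... | yes missed = missed
  ... | no none = ⊥-elim (x∉U (subst (x ∈_) (sym U≡U') x∈U'))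
    where
    U' : Subset m
    U' = U ∪ ⁅ x ⁆
    x∈U' : x ∈ U'
    x∈U' = x∈p∪q⁺ (inj₂ (x∈⁅x⁆ x))
    x-joined : ∀ y → y ∈ W → T (G x y)
    x-joined y y∈W with T? (G x y)
    ... | yes t = t
    ... | no ¬t = ⊥-elim (none (y , y∈W , ¬t))
    joined' : ∀ x' y → x' ∈ U' → y ∈ W → T (G x' y)
    joined' x' y x'∈U' y∈W with x∈p∪q⁻ U ⁅ x ⁆ x'∈U'
    ... | inj₁ x'∈U = joined x' y x'∈U y∈W
    ... | inj₂ x'∈x = subst (λ z → T (G z y)) (sym (x∈⁅y⁆⇒x≡y x x'∈x)) (x-joined y y∈W)
    U≡U' : U ≡ U'
    U≡U' = proj₁ (maximal U' W ((x , x∈U') , W-nonempty , joined') (p⊆p∪q ⁅ x ⁆) (λ y∈W → y∈W))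

  neighbourhood : Fin n → Subset m
  neighbourhood y = tabulate (λ x → G x y)

  common-neighbourhood : Subset m → Subset n
  common-neighbourhood U = tabulate (λ y → ⌊ all? (λ x → (x ∈? U) →-dec T? (G x y)) ⌋)

  common-neighbourhood⁺ : ∀ U y → (∀ x → x ∈ U → T (G x y)) → y ∈ common-neighbourhood U
  common-neighbourhood⁺ U y h = ∈-tabulate⁺ _ y (fromWitness (λ x → h x))

  common-neighbourhood⁻ : ∀ U y → y ∈ common-neighbourhood U → ∀ x → x ∈ U → T (G x y)
  common-neighbourhood⁻ U y y∈ = toWitness (∈-tabulate⁻ _ y y∈)

  -- The neighbourhood of y together with its common neighbourhood is a maximal biclique; so two
  -- vertices of X with a common neighbour y lie in a common maximal biclique.
  star : ∀ {x x' y} → T (G x y) → T (G x' y) → ∃ λ B → IsMaxBiclique G B × x ∈ proj₁ B × x' ∈ proj₁ B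
  star {x} {x'} {y} xy x'y = (N , CN) , (biclique , maximal) , ∈-tabulate⁺ _ x xy , ∈-tabulate⁺ _ x' x'y
    where
    N : Subset m
    N = neighbourhood y
    CN : Subset n
    CN = common-neighbourhood N
    y∈CN : y ∈ CN
    y∈CN = common-neighbourhood⁺ N y (λ z z∈N → ∈-tabulate⁻ _ z z∈N)
    biclique : IsBiclique G N CN
    biclique = (x , ∈-tabulate⁺ _ x xy) , (y , y∈CN) , λ z w z∈N w∈CN → common-neighbourhood⁻ N w w∈CN z z∈N
    maximal : ∀ U' W' → IsBiclique G U' W' → N ⊆ U' → CN ⊆ W' → (N ≡ U') × (CN ≡ W')
    maximal U' W' (_ , _ , joined) N⊆U' CN⊆W' =
      ⊆-antisym N⊆U' (λ {z} z∈U' → ∈-tabulate⁺ _ z (joined z y z∈U' (CN⊆W' y∈CN))) ,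
      ⊆-antisym CN⊆W' (λ {w} w∈W' → common-neighbourhood⁺ N w (λ z z∈N → joined z w (N⊆U' z∈N) w∈W'))

  nonempty : ∀ {B} → IsMaxBiclique G B → ∃ λ y → y ∈ proj₂ B
  nonempty {U , W} ((_ , W-nonempty , _) , _) = W-nonempty

  complete : ∀ {x y B} → IsMaxBiclique G B → x ∈ proj₁ B → y ∈ proj₂ B → T (G x y)
  complete {x} {y} {U , W} ((_ , _ , joined) , _) x∈U y∈W = joined x y x∈U y∈W

  Γ𝓧-shortest : BipartiteShortest (λ x y → T (G x y)) (λ _ → ⊤) (λ _ → ⊤) →
                BipartiteShortest (λ x B → x ∈ proj₁ B) (λ _ → ⊤) (IsMaxBiclique G)
  Γ𝓧-shortest = IncidenceLift.incidence-shortest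
    (λ x y → T (G x y)) (λ x B → x ∈ proj₁ B) (λ y B → y ∈ proj₂ B) (IsMaxBiclique G)
    (λ x y → T? (G x y)) (λ y B → y ∈? proj₂ B) any? nonempty complete outside-misses star

transpose : ∀ {m n} → BGraph m n → BGraph n m
transpose G y x = G x y

-- (U , W) is a maximal biclique of G iff (W , U) is one of its transpose; the converse direction
-- is this lemma applied to transpose G, as transpose (transpose G) is G.
transpose-biclique : ∀ {m n} {G : BGraph m n} {U W} → IsBiclique G U W → IsBiclique (transpose G) W U
transpose-biclique (U-nonempty , W-nonempty , joined) = W-nonempty , U-nonempty , λ y x y∈W x∈U → joined x y x∈U y∈W

transpose-max : ∀ {m n} {G : BGraph m n} {U W} → IsMaxBiclique G (U , W) → IsMaxBiclique (transpose G) (W , U)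
transpose-max {G = G} (biclique , maximal) =
  transpose-biclique biclique ,
  λ W' U' biclique' W⊆W' U⊆U' → let (U≡U' , W≡W') = maximal U' W' (transpose-biclique {G = transpose G} biclique') U⊆U' W⊆W'
                                in W≡W' , U≡U'

_≟Subset_ : ∀ {k} → DecidableEquality (Subset k)
_≟Subset_ = Vec.≡-dec Bool._≟_

_≟Biclique_ : ∀ {m n} → DecidableEquality (Subset m × Subset n)
_≟Biclique_ = Product.≡-dec _≟Subset_ _≟Subset_

corollary1 : ∀ (m n : ℕ) (G : BGraph m n) → BDH G → Γ𝓧-BDH G × Γ𝓨-BDH G
corollary1 m n G bdh = BipartiteCriterion.shortest⇒BDH _≟F_ _≟Biclique_ (λ x B → x ∈? proj₁ B) Γ𝓧 ,
                       BipartiteCriterion.shortest⇒BDH _≟F_ _≟Biclique_ (λ y B → y ∈? proj₂ B) Γ𝓨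
  where
  base : BipartiteShortest (λ x y → T (G x y)) (λ _ → ⊤) (λ _ → ⊤)
  base = BipartiteCriterion.BDH⇒shortest _≟F_ _≟F_ (λ x y → T? (G x y)) bdh
  Γ𝓧 : BipartiteShortest (λ x B → x ∈ proj₁ B) (λ _ → ⊤) (IsMaxBiclique G)
  Γ𝓧 = MaximalBicliques.Γ𝓧-shortest G base
  -- Γ(𝓨_G) is Γ(𝓧) of the transpose, up to swapping the two parts of each biclique
  Γ𝓨 : BipartiteShortest (λ y B → y ∈ proj₂ B) (λ _ → ⊤) (IsMaxBiclique G)
  Γ𝓨 = relabel-shortest pair-swap swap-injective (λ _ _ y∈ → y∈) (λ _ _ y∈ → y∈)
                        (λ { (U , W) → transpose-max })
                        (MaximalBicliques.Γ𝓧-shortest (transpose G) (swap-sides-shortest base))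
    where
    swap-injective : ∀ {B B' : Subset m × Subset n} → pair-swap B ≡ pair-swap B' → B ≡ B'
    swap-injective e = cong pair-swap e
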